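{- Let $1\le k\le n$. Let $\mathcal{A}$ be any algorithm which, given i.i.d. sample access to a distribution $\mathcal{D}\in\{\mathcal{U}_n\}\cup\mathcal{P}_n(k)$, outputs "un-truncated" with probability at least $99/100$ if $\mathcal{D}=\mathcal{U}_n$, and outputs "truncated" with probability at least $99/100$ if $\mathcal{D}\in\mathcal{P}_n(k)$. Then $\mathcal{A}$ must draw $\Omega\big(\log\binom{n}{k}\big)$ samples from $\mathcal{D}$.
   Context: Identify $\{0,1\}^n$ with $\mathbb{F}_2^n$; $\mathcal{U}_n$ is the uniform distribution on it. For $S\subseteq[n]$, the negated parity function $\chi_S:\mathbb{F}_2^n\to\mathbb{F}_2$ is $\chi_S(x):=1-\sum_{i\in S}x_i$ (computed in $\mathbb{F}_2$). $\mathcal{P}_n(k):=\{\mathcal{U}_n|_{\chi_S^{ -1}(1)} : S\subseteq[n], |S|=k\}$, where $\mathcal{U}_n|_{\chi_S^{ -1}(1)}$ is the uniform distribution on $\{x:\chi_S(x)=1\}$. Logarithms are base 2. -}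

module Defs where

open import Data.Bool using (Bool; true; false; not; _∧_; _xor_)
open import Data.Nat using (ℕ; zero; suc)
open import Data.Integer using (+_)
open import Data.Rational using (ℚ; _/_; _+_; _*_; _-_; 0ℚ; 1ℚ)
open import Data.List using (List; []; _∷_; map; filter; concatMap; length; foldr)
open import Data.Vec using (Vec; []; _∷_)
open import Data.Fin.Subset using (Subset)
open import Relation.Nullary.Decidable using (Dec)
open import Data.Bool using (T; T?)

-- Points of F₂ⁿ are Bool vectors (true = 1, false = 0, addition = xor).
Point : ℕ → Set
Point n = Vec Bool n

allPoints : (n : ℕ) → List (Point n)
allPoints zero    = [] ∷ []
allPoints (suc n) = concatMap (λ v → (false ∷ v) ∷ (true ∷ v) ∷ []) (allPoints n)

paritySum : ∀ {n} → Subset n → Point n → Bool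
paritySum []      []      = false
paritySum (s ∷ S) (x ∷ xs) = (s ∧ x) xor paritySum S xs

χ : ∀ {n} → Subset n → Point n → Bool
χ S x = not (paritySum S x)

-- support of U_n | χ_S⁻¹(1)
truncSupport : ∀ {n} → Subset n → List (Point n)
truncSupport {n} S = filter (λ x → T? (χ S x)) (allPoints n)

-- all m-tuples of elements of a list (i.i.d. uniform samples from a
-- uniform distribution on the list = uniform over this list of tuples)
tuples : ∀ {A : Set} → List A → (m : ℕ) → List (Vec A m)
tuples L zero    = [] ∷ []
tuples L (suc m) = concatMap (λ a → map (a ∷_) (tuples L m)) L

sumℚ : List ℚ → ℚ
sumℚ = foldr _+_ 0ℚ

ℕtoℚ : ℕ → ℚ
ℕtoℚ k = + k / 1

-- A (randomized) algorithm drawing m samples from F₂ⁿ, described by the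
-- probability (over its internal randomness) of outputting "un-truncated"
-- on each sample tuple.
Algorithm : ℕ → ℕ → Set
Algorithm n m = Vec (Point n) m → ℚ

-- Probability that the algorithm outputs "un-truncated" when its samples
-- are drawn i.i.d. from the uniform distribution on the list L, multiplied
-- by the number of sample tuples (to avoid division):
--   weightUntrunc L f = |L|^m · Pr[ output = un-truncated ]
weightUntrunc : ∀ {n m} → List (Point n) → Algorithm n m → ℚ
weightUntrunc {m = m} L f = sumℚ (map f (tuples L m))

weightTrunc : ∀ {n m} → List (Point n) → Algorithm n m → ℚ
weightTrunc {m = m} L f = sumℚ (map (λ t → 1ℚ - f t) (tuples L m))

numTuples : ∀ {n} → List (Point n) → ℕ → ℚ
numTuples L m = ℕtoℚ (length (tuples L m))

module Submission where

-- If m samples suffice although 2^m < C(n,k), choose ℓ = 2^m distinct k-subsets S and let A_S be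
-- the set of sample tuples lying entirely in χ_S⁻¹(1).  A nonconstant parity is balanced and two
-- distinct ones are independent (their xor is again a nonconstant parity), so with T the set of all
-- tuples, |A_S| = |T|/ℓ and |A_S ∩ A_S'| = |T|/ℓ² for S ≠ S'.  Let g = 1 - f be the probability of
-- answering "truncated" and j(t) the number of S with t ∈ A_S.  Summing 2jg + j ≤ 2g + j² over T
-- gives the second-moment bound 2 Σ_S Σ_{A_S} g ≤ 2 Σ_T g + |T|, whereas the tester's guarantees
-- make the left side at least 1.98 |T| and Σ_T g at most 0.01 |T|.

open import Defs
open import Algebra.Bundles using (CommutativeMonoid; CommutativeRing)
import Algebra.Properties.CommutativeSemigroup as CommutativeSemigroupProperties
open import Data.Bool using (Bool; true; false; not; _∧_; _xor_; if_then_else_)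
open import Data.Bool.Properties
  using (true-xor; xor-comm; ∧-zeroʳ; not-involutive; not-distribˡ-xor; xor-identityʳ; ∧-distribʳ-xor; xor-∧-commutativeRing)
open import Data.Fin using (suc)
open import Data.Fin.Subset using (Subset; inside; outside; ⊥; ∣_∣; Nonempty)
open import Data.Fin.Subset.Properties using (nonempty?; Empty-unique; ∣⊥∣≡0)
import Data.Integer as ℤ
import Data.Integer.Properties as ℤₚ
open import Data.List using (List; []; _∷_; _++_; map; concatMap; filterᵇ; length; take)
open import Data.List.Properties using (map-cong; map-∘; length-map; length-++; length-take)
open import Data.List.Membership.Propositional.Properties using (∈-map⁻)
open import Data.List.Relation.Unary.All as All using (All; []; _∷_)
import Data.List.Relation.Unary.All.Properties as All
import Data.List.Relation.Unary.AllPairs as AllPairs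
open import Data.List.Relation.Unary.Any using (here; there)
open import Data.List.Relation.Unary.Unique.Propositional using (Unique)
import Data.List.Relation.Unary.Unique.Propositional.Properties as Unique
import Data.List.Membership.Propositional as List
open import Data.Nat as ℕ using (ℕ; zero; suc; _^_)
import Data.Nat.Properties as ℕ
open import Data.Nat.Combinatorics using (_C_; nCk+nC[k+1]≡[n+1]C[k+1])
import Data.Nat.Coprimality as Coprime
open import Data.Product using (_×_; _,_; ∃-syntax; proj₁; proj₂)
open import Data.Rational
  using (ℚ; mkℚ; 0ℚ; 1ℚ; _+_; _*_; -_; _-_; _/_; _≤_; _<_; _<?_; positive; nonNegative)
open import Data.Rational.Properties
open import Data.Rational.Solver using (module +-*-Solver)
open import Data.Vec as Vec using (Vec; []; _∷_; zipWith)
open import Data.Vec.Properties using (∷-injective)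
open import Function using (_∘_)
open import Relation.Binary.PropositionalEquality
open import Relation.Nullary using (¬_; yes; no; contradiction)
open import Relation.Nullary.Decidable using (from-yes)

open CommutativeSemigroupProperties (CommutativeMonoid.commutativeSemigroup +-0-commutativeMonoid)
  using () renaming (interchange to +-interchange; x∙yz≈y∙xz to +-swapˡ; x∙yz≈xz∙y to +-swapʳ)
open CommutativeSemigroupProperties ℕ.+-commutativeSemigroup
  using () renaming (interchange to ℕ-+-interchange)
open CommutativeSemigroupProperties ℕ.*-commutativeSemigroup
  using () renaming (interchange to ℕ-*-interchange)
open CommutativeSemigroupProperties (CommutativeRing.+-commutativeSemigroup xor-∧-commutativeRing)
  using () renaming (interchange to xor-interchange)

^-distribʳ-* : ∀ x y m → (x ℕ.* y) ^ m ≡ x ^ m ℕ.* y ^ m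
^-distribʳ-* x y zero    = refl
^-distribʳ-* x y (suc m) =
  trans (cong (x ℕ.* y ℕ.*_) (^-distribʳ-* x y m)) (ℕ-*-interchange x y (x ^ m) (y ^ m))

ℕtoℚ≡mkℚ : ∀ k → ℕtoℚ k ≡ mkℚ (ℤ.+ k) 0 (Coprime.sym (Coprime.1-coprimeTo k))
ℕtoℚ≡mkℚ k = normalize-coprime (Coprime.sym (Coprime.1-coprimeTo k))

ℕtoℚ-suc : ∀ k → ℕtoℚ (suc k) ≡ 1ℚ + ℕtoℚ k
-- Normalisation is stuck on a variable numerator, but addition computes on the mkℚ form.
ℕtoℚ-suc k = begin
  ℤ.+ suc k / 1                      ≡⟨ cong (λ z → (ℤ.+ 1 ℤ.+ z) / 1) (ℤₚ.*-identityʳ (ℤ.+ k)) ⟨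
  (ℤ.+ 1 ℤ.+ ℤ.+ k ℤ.* ℤ.+ 1) / 1    ≡⟨⟩
  1ℚ + mkℚ (ℤ.+ k) 0 k⊥1             ≡⟨ cong (λ x → 1ℚ + x) (ℕtoℚ≡mkℚ k) ⟨
  1ℚ + ℕtoℚ k                        ∎
  where
  open ≡-Reasoning
  k⊥1 = Coprime.sym (Coprime.1-coprimeTo k)

ℕtoℚ-+ : ∀ j k → ℕtoℚ (j ℕ.+ k) ≡ ℕtoℚ j + ℕtoℚ k
ℕtoℚ-+ zero    k = sym (+-identityˡ (ℕtoℚ k))
ℕtoℚ-+ (suc j) k = begin
  ℕtoℚ (suc (j ℕ.+ k))        ≡⟨ ℕtoℚ-suc (j ℕ.+ k) ⟩
  1ℚ + ℕtoℚ (j ℕ.+ k)         ≡⟨ cong (λ x → 1ℚ + x) (ℕtoℚ-+ j k) ⟩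
  1ℚ + (ℕtoℚ j + ℕtoℚ k)      ≡⟨ +-assoc 1ℚ (ℕtoℚ j) (ℕtoℚ k) ⟨
  (1ℚ + ℕtoℚ j) + ℕtoℚ k      ≡⟨ cong (_+ ℕtoℚ k) (ℕtoℚ-suc j) ⟨
  ℕtoℚ (suc j) + ℕtoℚ k       ∎
  where open ≡-Reasoning

ℕtoℚ-suc-* : ∀ k c → ℕtoℚ (suc k) * c ≡ c + ℕtoℚ k * c
ℕtoℚ-suc-* k c = begin
  ℕtoℚ (suc k) * c          ≡⟨ cong (_* c) (ℕtoℚ-suc k) ⟩
  (1ℚ + ℕtoℚ k) * c         ≡⟨ *-distribʳ-+ c 1ℚ (ℕtoℚ k) ⟩
  1ℚ * c + ℕtoℚ k * c       ≡⟨ cong (_+ ℕtoℚ k * c) (*-identityˡ c) ⟩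
  c + ℕtoℚ k * c            ∎
  where open ≡-Reasoning

ℕtoℚ-* : ∀ j k → ℕtoℚ (j ℕ.* k) ≡ ℕtoℚ j * ℕtoℚ k
ℕtoℚ-* zero    k = sym (*-zeroˡ (ℕtoℚ k))
ℕtoℚ-* (suc j) k = begin
  ℕtoℚ (k ℕ.+ j ℕ.* k)         ≡⟨ ℕtoℚ-+ k (j ℕ.* k) ⟩
  ℕtoℚ k + ℕtoℚ (j ℕ.* k)      ≡⟨ cong (ℕtoℚ k +_) (ℕtoℚ-* j k) ⟩
  ℕtoℚ k + ℕtoℚ j * ℕtoℚ k     ≡⟨ ℕtoℚ-suc-* j (ℕtoℚ k) ⟨
  ℕtoℚ (suc j) * ℕtoℚ k        ∎
  where open ≡-Reasoning

ℕtoℚ-doubling : ∀ n m → ℕtoℚ (2 ^ m) * ℕtoℚ ((2 ^ n) ^ m) ≡ ℕtoℚ ((2 ^ suc n) ^ m)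
ℕtoℚ-doubling n m = trans (sym (ℕtoℚ-* (2 ^ m) ((2 ^ n) ^ m))) (cong ℕtoℚ (sym (^-distribʳ-* 2 (2 ^ n) m)))

ℕtoℚ-nonNeg : ∀ k → 0ℚ ≤ ℕtoℚ k
ℕtoℚ-nonNeg k = subst (0ℚ ≤_) (sym (ℕtoℚ≡mkℚ k)) (nonNegative⁻¹ _)

ℕtoℚ-mono : ∀ {j k} → j ℕ.≤ k → ℕtoℚ j ≤ ℕtoℚ k
ℕtoℚ-mono {j} j≤k with ℕ.m≤n⇒∃[o]m+o≡n j≤k
... | o , refl = begin
  ℕtoℚ j              ≡⟨ +-identityʳ (ℕtoℚ j) ⟨
  ℕtoℚ j + 0ℚ         ≤⟨ +-monoʳ-≤ (ℕtoℚ j) (ℕtoℚ-nonNeg o) ⟩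
  ℕtoℚ j + ℕtoℚ o     ≡⟨ ℕtoℚ-+ j o ⟨
  ℕtoℚ (j ℕ.+ o)      ∎
  where open ≤-Reasoning

+-cancelʳ-≤ : ∀ c {a b} → a + c ≤ b + c → a ≤ b
+-cancelʳ-≤ c {a} {b} a+c≤b+c = begin
  a                   ≡⟨ undo a ⟩
  (a + c) + - c       ≤⟨ +-monoˡ-≤ (- c) a+c≤b+c ⟩
  (b + c) + - c       ≡⟨ undo b ⟨
  b                   ∎
  where
  open ≤-Reasoning
  undo : ∀ x → x ≡ (x + c) + - c
  undo x = solve 2 (λ x c → x := (x :+ c) :+ (:- c)) refl x c
    where open +-*-Solver

1-x∈[0,1] : ∀ {x} → 0ℚ ≤ x → x ≤ 1ℚ → (0ℚ ≤ 1ℚ - x) × (1ℚ - x ≤ 1ℚ)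
1-x∈[0,1] 0≤x x≤1 = +-monoʳ-≤ 1ℚ (neg-antimono-≤ x≤1) , +-monoʳ-≤ 1ℚ (neg-antimono-≤ 0≤x)

private variable A B : Set

∑ : List A → (A → ℚ) → ℚ
∑ xs h = sumℚ (map h xs)

syntax ∑ xs (λ x → h) = ∑[ x ∈ xs ] h

infixr 7 [_]·_
[_]·_ : Bool → ℚ → ℚ
[ b ]· x = if b then x else 0ℚ

[]·-∧ : ∀ a b x → [ a ]· [ b ]· x ≡ [ a ∧ b ]· x
[]·-∧ true  b x = refl
[]·-∧ false b x = refl

[]·-idem : ∀ b x → [ b ]· [ b ]· x ≡ [ b ]· x
[]·-idem true  x = refl
[]·-idem false x = refl

bit : Bool → ℕ
bit true  = 1
bit false = 0

count : (A → Bool) → List A → ℕ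
count p []       = 0
count p (x ∷ xs) = bit (p x) ℕ.+ count p xs

∑-cong : ∀ {h h' : A → ℚ} xs → (∀ x → h x ≡ h' x) → ∑ xs h ≡ ∑ xs h'
∑-cong xs h≗h' = cong sumℚ (map-cong h≗h' xs)

∑-mono : ∀ {h h' : A → ℚ} xs → (∀ {x} → x List.∈ xs → h x ≤ h' x) → ∑ xs h ≤ ∑ xs h'
∑-mono []       h≤h' = ≤-refl
∑-mono (x ∷ xs) h≤h' = +-mono-≤ (h≤h' (here refl)) (∑-mono xs (h≤h' ∘ there))

∑-map : ∀ (k : B → A) (h : A → ℚ) xs → ∑ (map k xs) h ≡ ∑[ x ∈ xs ] h (k x)
∑-map k h xs = cong sumℚ (sym (map-∘ xs))

∑-++ : ∀ (h : A → ℚ) xs ys → ∑ (xs ++ ys) h ≡ ∑ xs h + ∑ ys h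
∑-++ h []       ys = sym (+-identityˡ (∑ ys h))
∑-++ h (x ∷ xs) ys = trans (cong (h x +_) (∑-++ h xs ys)) (sym (+-assoc (h x) (∑ xs h) (∑ ys h)))

∑-concatMap : ∀ (g : B → List A) (h : A → ℚ) xs → ∑ (concatMap g xs) h ≡ ∑[ x ∈ xs ] ∑ (g x) h
∑-concatMap g h []       = refl
∑-concatMap g h (x ∷ xs) = trans (∑-++ h (g x) (concatMap g xs)) (cong (∑ (g x) h +_) (∑-concatMap g h xs))

∑-zero : ∀ (xs : List A) → ∑[ x ∈ xs ] 0ℚ ≡ 0ℚ
∑-zero []       = refl
∑-zero (x ∷ xs) = trans (+-identityˡ _) (∑-zero xs)

∑-+ : ∀ (h h' : A → ℚ) xs → ∑[ x ∈ xs ] (h x + h' x) ≡ ∑ xs h + ∑ xs h'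
∑-+ h h' []       = refl
∑-+ h h' (x ∷ xs) = trans (cong (h x + h' x +_) (∑-+ h h' xs)) (+-interchange (h x) (h' x) (∑ xs h) (∑ xs h'))

∑-[]· : ∀ b (h : A → ℚ) xs → ∑[ x ∈ xs ] ([ b ]· h x) ≡ [ b ]· ∑ xs h
∑-[]· true  h xs = refl
∑-[]· false h xs = ∑-zero xs

∑-filterᵇ : ∀ (p : A → Bool) (h : A → ℚ) xs → ∑ (filterᵇ p xs) h ≡ ∑[ x ∈ xs ] ([ p x ]· h x)
∑-filterᵇ p h []       = refl
∑-filterᵇ p h (x ∷ xs) with p x
... | true  = cong (h x +_) (∑-filterᵇ p h xs)
... | false = trans (∑-filterᵇ p h xs) (sym (+-identityˡ _))

∑-indicator : ∀ (p : A → Bool) c xs → ∑[ x ∈ xs ] ([ p x ]· c) ≡ ℕtoℚ (count p xs) * c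
∑-indicator p c []       = sym (*-zeroˡ c)
∑-indicator p c (x ∷ xs) with p x
... | true  = trans (cong (c +_) (∑-indicator p c xs)) (sym (ℕtoℚ-suc-* (count p xs) c))
... | false = trans (+-identityˡ _) (∑-indicator p c xs)

count-true : ∀ (xs : List A) → count (λ _ → true) xs ≡ length xs
count-true []       = refl
count-true (x ∷ xs) = cong suc (count-true xs)

∑-const : ∀ c (xs : List A) → ∑[ x ∈ xs ] c ≡ ℕtoℚ (length xs) * c
∑-const c xs = trans (∑-indicator (λ _ → true) c xs) (cong (λ k → ℕtoℚ k * c) (count-true xs))

∑-comm : ∀ (F : A → B → ℚ) xs ys → ∑[ x ∈ xs ] ∑[ y ∈ ys ] F x y ≡ ∑[ y ∈ ys ] ∑[ x ∈ xs ] F x y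
∑-comm F []       ys = sym (∑-zero ys)
∑-comm F (x ∷ xs) ys =
  trans (cong (∑ ys (F x) +_) (∑-comm F xs ys)) (sym (∑-+ (F x) (λ y → ∑[ x' ∈ xs ] F x' y) ys))

∑-unique-bound : ∀ {xs : List A} (h : A → ℚ) {x c} → Unique xs → x List.∈ xs → 0ℚ ≤ c →
  (∀ {y} → y List.∈ xs → y ≢ x → h y ≤ c) → ∑ xs h ≤ h x + ℕtoℚ (length xs) * c
∑-unique-bound {xs = y ∷ ys} h {c = c} (y∉ys AllPairs.∷ _) (here refl) 0≤c h≤c = begin
  h y + ∑ ys h                       ≤⟨ +-monoʳ-≤ (h y) (∑-mono ys (λ z∈ys → h≤c (there z∈ys) (≢-sym (All.lookup y∉ys z∈ys)))) ⟩
  h y + ∑[ z ∈ ys ] c                ≡⟨ cong (h y +_) (∑-const c ys) ⟩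
  h y + ℕtoℚ (length ys) * c         ≡⟨ cong (h y +_) (+-identityˡ _) ⟨
  h y + (0ℚ + ℕtoℚ (length ys) * c)  ≤⟨ +-monoʳ-≤ (h y) (+-monoˡ-≤ (ℕtoℚ (length ys) * c) 0≤c) ⟩
  h y + (c + ℕtoℚ (length ys) * c)   ≡⟨ cong (h y +_) (ℕtoℚ-suc-* (length ys) c) ⟨
  h y + ℕtoℚ (length (y ∷ ys)) * c   ∎
  where open ≤-Reasoning
∑-unique-bound {xs = y ∷ ys} h {x} {c} (y∉ys AllPairs.∷ ys-unique) (there x∈ys) 0≤c h≤c = begin
  h y + ∑ ys h                      ≤⟨ +-mono-≤ (h≤c (here refl) (All.lookup y∉ys x∈ys))
                                                (∑-unique-bound h ys-unique x∈ys 0≤c (h≤c ∘ there)) ⟩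
  c + (h x + ℕtoℚ (length ys) * c)  ≡⟨ +-swapˡ c (h x) _ ⟩
  h x + (c + ℕtoℚ (length ys) * c)  ≡⟨ cong (h x +_) (ℕtoℚ-suc-* (length ys) c) ⟨
  h x + ℕtoℚ (length (y ∷ ys)) * c  ∎
  where open ≤-Reasoning

count-cong : ∀ {p q : A → Bool} xs → (∀ x → p x ≡ q x) → count p xs ≡ count q xs
count-cong []       p≗q = refl
count-cong (x ∷ xs) p≗q = cong₂ ℕ._+_ (cong bit (p≗q x)) (count-cong xs p≗q)

length-filterᵇ : ∀ (p : A → Bool) xs → length (filterᵇ p xs) ≡ count p xs
length-filterᵇ p []       = refl
length-filterᵇ p (x ∷ xs) with p x
... | true  = cong suc (length-filterᵇ p xs)
... | false = length-filterᵇ p xs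

count-complement : ∀ (p : A → Bool) xs → count p xs ℕ.+ count (not ∘ p) xs ≡ length xs
count-complement p []       = refl
count-complement p (x ∷ xs) with p x
... | true  = cong suc (count-complement p xs)
... | false = trans (ℕ.+-suc _ _) (cong suc (count-complement p xs))

count-xor : ∀ (p q : A → Bool) xs →
  count p xs ℕ.+ count q xs ≡ 2 ℕ.* count (λ x → p x ∧ q x) xs ℕ.+ count (λ x → p x xor q x) xs
count-xor p q []       = refl
count-xor p q (x ∷ xs) = begin
  (bit (p x) ℕ.+ count p xs) ℕ.+ (bit (q x) ℕ.+ count q xs)
    ≡⟨ ℕ-+-interchange (bit (p x)) _ (bit (q x)) _ ⟩
  (bit (p x) ℕ.+ bit (q x)) ℕ.+ (count p xs ℕ.+ count q xs)
    ≡⟨ cong₂ ℕ._+_ (bits (p x) (q x)) (count-xor p q xs) ⟩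
  (2 ℕ.* bit (p x ∧ q x) ℕ.+ bit (p x xor q x)) ℕ.+ (2 ℕ.* c∧ ℕ.+ c⊕)
    ≡⟨ ℕ-+-interchange (2 ℕ.* bit (p x ∧ q x)) _ (2 ℕ.* c∧) _ ⟩
  (2 ℕ.* bit (p x ∧ q x) ℕ.+ 2 ℕ.* c∧) ℕ.+ (bit (p x xor q x) ℕ.+ c⊕)
    ≡⟨ cong (ℕ._+ (bit (p x xor q x) ℕ.+ c⊕)) (ℕ.*-distribˡ-+ 2 (bit (p x ∧ q x)) c∧) ⟨
  2 ℕ.* (bit (p x ∧ q x) ℕ.+ c∧) ℕ.+ (bit (p x xor q x) ℕ.+ c⊕)
    ∎
  where
  open ≡-Reasoning
  c∧ = count (λ x → p x ∧ q x) xs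
  c⊕ = count (λ x → p x xor q x) xs
  bits : ∀ a b → bit a ℕ.+ bit b ≡ 2 ℕ.* bit (a ∧ b) ℕ.+ bit (a xor b)
  bits true  true  = refl
  bits true  false = refl
  bits false true  = refl
  bits false false = refl

-- Parities on the Boolean cube

count-allPoints-suc : ∀ n (p : Point (suc n) → Bool) →
  count p (allPoints (suc n)) ≡ count (p ∘ (false ∷_)) (allPoints n) ℕ.+ count (p ∘ (true ∷_)) (allPoints n)
count-allPoints-suc n p = split (allPoints n)
  where
  split : ∀ vs → count p (concatMap (λ v → (false ∷ v) ∷ (true ∷ v) ∷ []) vs)
                   ≡ count (p ∘ (false ∷_)) vs ℕ.+ count (p ∘ (true ∷_)) vs
  split []       = refl
  split (v ∷ vs) = trans (cong (λ c → a ℕ.+ (b ℕ.+ c)) (split vs))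
                         (trans (sym (ℕ.+-assoc a b (c₀ ℕ.+ c₁))) (ℕ-+-interchange a b c₀ c₁))
    where
    a = bit (p (false ∷ v))
    b = bit (p (true ∷ v))
    c₀ = count (p ∘ (false ∷_)) vs
    c₁ = count (p ∘ (true ∷_)) vs

length-allPoints : ∀ n → length (allPoints n) ≡ 2 ^ n
length-allPoints zero    = refl
length-allPoints (suc n) = begin
  length (allPoints (suc n))                                             ≡⟨ count-true (allPoints (suc n)) ⟨
  count (λ _ → true) (allPoints (suc n))                                 ≡⟨ count-allPoints-suc n _ ⟩
  count (λ _ → true) (allPoints n) ℕ.+ count (λ _ → true) (allPoints n)  ≡⟨ cong₂ ℕ._+_ half half ⟩
  2 ^ n ℕ.+ 2 ^ n                                                        ≡⟨ cong (2 ^ n ℕ.+_) (ℕ.+-identityʳ (2 ^ n)) ⟨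
  2 ^ suc n                                                              ∎
  where
  open ≡-Reasoning
  half = trans (count-true (allPoints n)) (length-allPoints n)

parity-balanced : ∀ {n} (S : Subset n) → Nonempty S → ∀ b →
  2 ℕ.* count (λ x → paritySum S x xor b) (allPoints n) ≡ 2 ^ n
parity-balanced {suc n} (inside ∷ S) _ b = cong (2 ℕ.*_) (begin
  count (λ x → paritySum (inside ∷ S) x xor b) (allPoints (suc n))  ≡⟨ count-allPoints-suc n _ ⟩
  count p (allPoints n) ℕ.+ count (λ v → not (paritySum S v) xor b) (allPoints n)
    ≡⟨ cong (count p (allPoints n) ℕ.+_) (count-cong (allPoints n) (λ v → not-distribˡ-xor (paritySum S v) b)) ⟨
  count p (allPoints n) ℕ.+ count (not ∘ p) (allPoints n)            ≡⟨ count-complement p (allPoints n) ⟩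
  length (allPoints n)                                               ≡⟨ length-allPoints n ⟩
  2 ^ n                                                              ∎)
  where
  open ≡-Reasoning
  p = λ v → paritySum S v xor b
parity-balanced {suc n} (outside ∷ S) (suc i , Vec.there i∈S) b = begin
  2 ℕ.* count (λ x → paritySum (outside ∷ S) x xor b) (allPoints (suc n))
                            ≡⟨ cong (2 ℕ.*_) (count-allPoints-suc n _) ⟩
  2 ℕ.* (c ℕ.+ c)           ≡⟨ ℕ.*-distribˡ-+ 2 c c ⟩
  2 ℕ.* c ℕ.+ 2 ℕ.* c       ≡⟨ cong₂ ℕ._+_ half half ⟩
  2 ^ n ℕ.+ 2 ^ n           ≡⟨ cong (2 ^ n ℕ.+_) (ℕ.+-identityʳ (2 ^ n)) ⟨
  2 ^ suc n                 ∎
  where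
  open ≡-Reasoning
  c = count (λ v → paritySum S v xor b) (allPoints n)
  half = parity-balanced S (i , i∈S) b

χ≡paritySum-xor-true : ∀ {n} (S : Subset n) x → χ S x ≡ paritySum S x xor true
χ≡paritySum-xor-true S x = trans (sym (true-xor (paritySum S x))) (xor-comm true (paritySum S x))

χ-balanced : ∀ {n} (S : Subset n) → Nonempty S → 2 ℕ.* count (χ S) (allPoints n) ≡ 2 ^ n
χ-balanced {n} S S≢∅ =
  trans (cong (2 ℕ.*_) (count-cong (allPoints n) (χ≡paritySum-xor-true S))) (parity-balanced S S≢∅ true)

count-truncation : ∀ {n} (S : Subset (suc n)) → Nonempty S → count (χ S) (allPoints (suc n)) ≡ 2 ^ n
count-truncation {n} S S≢∅ = ℕ.*-cancelˡ-≡ _ (2 ^ n) 2 (χ-balanced S S≢∅)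

infixl 6 _⊕_
_⊕_ : ∀ {n} → Subset n → Subset n → Subset n
_⊕_ = zipWith _xor_

paritySum-⊕ : ∀ {n} (S S' : Subset n) x → paritySum (S ⊕ S') x ≡ paritySum S x xor paritySum S' x
paritySum-⊕ []       []         []       = refl
paritySum-⊕ (s ∷ S) (s' ∷ S') (x ∷ xs) = begin
  ((s xor s') ∧ x) xor paritySum (S ⊕ S') xs
    ≡⟨ cong₂ _xor_ (∧-distribʳ-xor x s s') (paritySum-⊕ S S' xs) ⟩
  ((s ∧ x) xor (s' ∧ x)) xor (paritySum S xs xor paritySum S' xs)
    ≡⟨ xor-interchange (s ∧ x) (s' ∧ x) (paritySum S xs) (paritySum S' xs) ⟩
  ((s ∧ x) xor paritySum S xs) xor ((s' ∧ x) xor paritySum S' xs) ∎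
  where open ≡-Reasoning

⊕≡⊥⇒≡ : ∀ {n} (S S' : Subset n) → S ⊕ S' ≡ ⊥ → S ≡ S'
⊕≡⊥⇒≡ []      []        _  = refl
⊕≡⊥⇒≡ (s ∷ S) (s' ∷ S') eq = cong₂ _∷_ (xor≡false⇒≡ s s' (proj₁ (∷-injective eq))) (⊕≡⊥⇒≡ S S' (proj₂ (∷-injective eq)))
  where
  xor≡false⇒≡ : ∀ a b → a xor b ≡ false → a ≡ b
  xor≡false⇒≡ false false _ = refl
  xor≡false⇒≡ true  true  _ = refl
  xor≡false⇒≡ false true  ()
  xor≡false⇒≡ true  false ()

⊕-nonempty : ∀ {n} {S S' : Subset n} → S ≢ S' → Nonempty (S ⊕ S')
⊕-nonempty {S = S} {S'} S≢S' with nonempty? (S ⊕ S')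
... | yes S⊕S'≢∅ = S⊕S'≢∅
... | no  S⊕S'≡∅ = contradiction (⊕≡⊥⇒≡ S S' (Empty-unique S⊕S'≡∅)) S≢S'

∣p∣>0⇒Nonempty : ∀ {n} (S : Subset n) → 0 ℕ.< ∣ S ∣ → Nonempty S
∣p∣>0⇒Nonempty {n} S ∣S∣>0 with nonempty? S
... | yes S≢∅ = S≢∅
... | no  S≡∅ = contradiction (trans (cong ∣_∣ (Empty-unique S≡∅)) (∣⊥∣≡0 n)) (ℕ.>⇒≢ ∣S∣>0)

-- χ_S xor χ_S' is the parity of S ⊕ S', so it is balanced as well, and then
-- |A| + |B| = 2 |A ∩ B| + |A xor B| leaves |A ∩ B| = 2^(2+n) / 4.
count-truncation-pair : ∀ {n} (S S' : Subset (2 ℕ.+ n)) → Nonempty S → Nonempty S' → S ≢ S' →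
  count (λ x → χ S x ∧ χ S' x) (allPoints (2 ℕ.+ n)) ≡ 2 ^ n
count-truncation-pair {n} S S' S≢∅ S'≢∅ S≢S' = ℕ.*-cancelˡ-≡ c (2 ^ n) 4
  (trans (ℕ.+-cancelʳ-≡ N (4 ℕ.* c) N quarter) (sym (ℕ.*-assoc 2 2 (2 ^ n))))
  where
  open ≡-Reasoning
  P = allPoints (2 ℕ.+ n)
  N = 2 ^ (2 ℕ.+ n)
  c = count (λ x → χ S x ∧ χ S' x) P
  c⊕ = count (λ x → χ S x xor χ S' x) P
  χ-xor : ∀ x → χ S x xor χ S' x ≡ paritySum (S ⊕ S') x xor false
  χ-xor x = begin
    not (paritySum S x) xor not (paritySum S' x)  ≡⟨ not-xor-not (paritySum S x) (paritySum S' x) ⟩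
    paritySum S x xor paritySum S' x             ≡⟨ paritySum-⊕ S S' x ⟨
    paritySum (S ⊕ S') x                         ≡⟨ xor-identityʳ _ ⟨
    paritySum (S ⊕ S') x xor false               ∎
    where
    not-xor-not : ∀ a b → not a xor not b ≡ a xor b
    not-xor-not true  b = refl
    not-xor-not false b = not-involutive b
  xor-balanced : 2 ℕ.* c⊕ ≡ N
  xor-balanced = trans (cong (2 ℕ.*_) (count-cong P χ-xor)) (parity-balanced (S ⊕ S') (⊕-nonempty S≢S') false)
  quarter : 4 ℕ.* c ℕ.+ N ≡ N ℕ.+ N
  quarter = begin
    4 ℕ.* c ℕ.+ N                                   ≡⟨ cong (4 ℕ.* c ℕ.+_) xor-balanced ⟨
    4 ℕ.* c ℕ.+ 2 ℕ.* c⊕                            ≡⟨ cong (ℕ._+ 2 ℕ.* c⊕) (ℕ.*-assoc 2 2 c) ⟩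
    2 ℕ.* (2 ℕ.* c) ℕ.+ 2 ℕ.* c⊕                    ≡⟨ ℕ.*-distribˡ-+ 2 (2 ℕ.* c) c⊕ ⟨
    2 ℕ.* (2 ℕ.* c ℕ.+ c⊕)                          ≡⟨ cong (2 ℕ.*_) (count-xor (χ S) (χ S') P) ⟨
    2 ℕ.* (count (χ S) P ℕ.+ count (χ S') P)        ≡⟨ ℕ.*-distribˡ-+ 2 (count (χ S) P) (count (χ S') P) ⟩
    2 ℕ.* count (χ S) P ℕ.+ 2 ℕ.* count (χ S') P    ≡⟨ cong₂ ℕ._+_ (χ-balanced S S≢∅) (χ-balanced S' S'≢∅) ⟩
    N ℕ.+ N                                         ∎

-- Subsets of a given size

subsetsOfSize : ∀ n → ℕ → List (Subset n)
subsetsOfSize zero    zero    = [] ∷ []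
subsetsOfSize zero    (suc k) = []
subsetsOfSize (suc n) zero    = map (outside ∷_) (subsetsOfSize n zero)
subsetsOfSize (suc n) (suc k) = map (inside ∷_) (subsetsOfSize n k) ++ map (outside ∷_) (subsetsOfSize n (suc k))

length-subsetsOfSize : ∀ n k → length (subsetsOfSize n k) ≡ n C k
length-subsetsOfSize zero    zero    = refl
length-subsetsOfSize zero    (suc k) = refl
length-subsetsOfSize (suc n) zero    = trans (length-map _ (subsetsOfSize n zero)) (length-subsetsOfSize n zero)
length-subsetsOfSize (suc n) (suc k) = begin
  length (map (inside ∷_) (subsetsOfSize n k) ++ map (outside ∷_) (subsetsOfSize n (suc k)))
    ≡⟨ length-++ (map (inside ∷_) (subsetsOfSize n k)) ⟩
  length (map (inside ∷_) (subsetsOfSize n k)) ℕ.+ length (map (outside ∷_) (subsetsOfSize n (suc k)))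
    ≡⟨ cong₂ ℕ._+_ (length-map _ (subsetsOfSize n k)) (length-map _ (subsetsOfSize n (suc k))) ⟩
  length (subsetsOfSize n k) ℕ.+ length (subsetsOfSize n (suc k))
    ≡⟨ cong₂ ℕ._+_ (length-subsetsOfSize n k) (length-subsetsOfSize n (suc k)) ⟩
  n C k ℕ.+ n C suc k
    ≡⟨ nCk+nC[k+1]≡[n+1]C[k+1] n k ⟩
  suc n C suc k ∎
  where open ≡-Reasoning

subsetsOfSize-size : ∀ n k → All (λ S → ∣ S ∣ ≡ k) (subsetsOfSize n k)
subsetsOfSize-size zero    zero    = refl ∷ []
subsetsOfSize-size zero    (suc k) = []
subsetsOfSize-size (suc n) zero    = All.map⁺ (subsetsOfSize-size n zero)
subsetsOfSize-size (suc n) (suc k) =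
  All.++⁺ (All.map⁺ (All.map (cong suc) (subsetsOfSize-size n k))) (All.map⁺ (subsetsOfSize-size n (suc k)))

subsetsOfSize-unique : ∀ n k → Unique (subsetsOfSize n k)
subsetsOfSize-unique zero    zero    = [] AllPairs.∷ AllPairs.[]
subsetsOfSize-unique zero    (suc k) = AllPairs.[]
subsetsOfSize-unique (suc n) zero    = Unique.map⁺ (proj₂ ∘ ∷-injective) (subsetsOfSize-unique n zero)
subsetsOfSize-unique (suc n) (suc k) = Unique.++⁺
  (Unique.map⁺ (proj₂ ∘ ∷-injective) (subsetsOfSize-unique n k))
  (Unique.map⁺ (proj₂ ∘ ∷-injective) (subsetsOfSize-unique n (suc k)))
  disjoint
  where
  disjoint : ∀ {S} → ¬ (S List.∈ map (inside ∷_) (subsetsOfSize n k) × S List.∈ map (outside ∷_) (subsetsOfSize n (suc k)))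
  disjoint (S∈ins , S∈outs) with ∈-map⁻ (inside ∷_) S∈ins | ∈-map⁻ (outside ∷_) S∈outs
  ... | _ , _ , refl | _ , _ , ()

-- Tuples of samples

allᵇ : ∀ {m} → (A → Bool) → Vec A m → Bool
allᵇ p []       = true
allᵇ p (x ∷ xs) = p x ∧ allᵇ p xs

allᵇ-∧ : ∀ {m} (p q : A → Bool) (t : Vec A m) → allᵇ p t ∧ allᵇ q t ≡ allᵇ (λ x → p x ∧ q x) t
allᵇ-∧ p q []      = refl
allᵇ-∧ p q (x ∷ t) with p x | q x
... | true  | true  = allᵇ-∧ p q t
... | true  | false = ∧-zeroʳ (allᵇ p t)
... | false | _     = refl

length-tuples : ∀ (xs : List A) m → length (tuples xs m) ≡ length xs ^ m
length-tuples xs zero    = refl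
length-tuples xs (suc m) = trans (extend xs) (cong (length xs ℕ.*_) (length-tuples xs m))
  where
  extend : ∀ ys → length (concatMap (λ a → map (a ∷_) (tuples xs m)) ys) ≡ length ys ℕ.* length (tuples xs m)
  extend []       = refl
  extend (y ∷ ys) = trans (length-++ (map (y ∷_) (tuples xs m)))
                          (cong₂ ℕ._+_ (length-map (y ∷_) (tuples xs m)) (extend ys))

length-tuples-filterᵇ : ∀ (p : A → Bool) xs m → length (tuples (filterᵇ p xs) m) ≡ count p xs ^ m
length-tuples-filterᵇ p xs m = trans (length-tuples (filterᵇ p xs) m) (cong (_^ m) (length-filterᵇ p xs))

∑-tuples-filterᵇ : ∀ (p : A → Bool) xs m (h : Vec A m → ℚ) →
  ∑ (tuples (filterᵇ p xs) m) h ≡ ∑[ t ∈ tuples xs m ] ([ allᵇ p t ]· h t)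
∑-tuples-filterᵇ p xs zero    h = refl
∑-tuples-filterᵇ p xs (suc m) h = begin
  ∑ (concatMap (λ a → map (a ∷_) (tuples F m)) F) h
    ≡⟨ ∑-concatMap (λ a → map (a ∷_) (tuples F m)) h F ⟩
  ∑[ a ∈ F ] ∑ (map (a ∷_) (tuples F m)) h
    ≡⟨ ∑-cong F (λ a → trans (∑-map (a ∷_) h (tuples F m)) (∑-tuples-filterᵇ p xs m (h ∘ (a ∷_)))) ⟩
  ∑[ a ∈ F ] ∑[ t ∈ tuples xs m ] ([ allᵇ p t ]· h (a ∷ t))
    ≡⟨ ∑-filterᵇ p _ xs ⟩
  ∑[ a ∈ xs ] ([ p a ]· ∑[ t ∈ tuples xs m ] ([ allᵇ p t ]· h (a ∷ t)))
    ≡⟨ ∑-cong xs (λ a → sym (∑-[]· (p a) _ (tuples xs m))) ⟩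
  ∑[ a ∈ xs ] ∑[ t ∈ tuples xs m ] ([ p a ]· [ allᵇ p t ]· h (a ∷ t))
    ≡⟨ ∑-cong xs (λ a → ∑-cong (tuples xs m) (λ t → []·-∧ (p a) (allᵇ p t) (h (a ∷ t)))) ⟩
  ∑[ a ∈ xs ] ∑[ t ∈ tuples xs m ] ([ allᵇ p (a ∷ t) ]· h (a ∷ t))
    ≡⟨ ∑-cong xs (λ a → ∑-map (a ∷_) (λ t → [ allᵇ p t ]· h t) (tuples xs m)) ⟨
  ∑[ a ∈ xs ] ∑ (map (a ∷_) (tuples xs m)) (λ t → [ allᵇ p t ]· h t)
    ≡⟨ ∑-concatMap (λ a → map (a ∷_) (tuples xs m)) (λ t → [ allᵇ p t ]· h t) xs ⟨
  ∑ (concatMap (λ a → map (a ∷_) (tuples xs m)) xs) (λ t → [ allᵇ p t ]· h t) ∎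
  where
  open ≡-Reasoning
  F = filterᵇ p xs

∑-tuples-allᵇ : ∀ (p : A → Bool) xs m → ∑[ t ∈ tuples xs m ] ([ allᵇ p t ]· 1ℚ) ≡ ℕtoℚ (count p xs ^ m)
∑-tuples-allᵇ p xs m = begin
  ∑[ t ∈ tuples xs m ] ([ allᵇ p t ]· 1ℚ)               ≡⟨ ∑-tuples-filterᵇ p xs m (λ _ → 1ℚ) ⟨
  ∑[ t ∈ tuples (filterᵇ p xs) m ] 1ℚ                   ≡⟨ ∑-const 1ℚ (tuples (filterᵇ p xs) m) ⟩
  ℕtoℚ (length (tuples (filterᵇ p xs) m)) * 1ℚ          ≡⟨ *-identityʳ _ ⟩
  ℕtoℚ (length (tuples (filterᵇ p xs) m))               ≡⟨ cong ℕtoℚ (length-tuples-filterᵇ p xs m) ⟩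
  ℕtoℚ (count p xs ^ m)                                 ∎
  where open ≡-Reasoning

-- The second-moment bound

2jx+j≤2x+j² : ∀ j x → 0ℚ ≤ x → x ≤ 1ℚ → (ℕtoℚ j * x + ℕtoℚ j * x) + ℕtoℚ j ≤ (x + x) + ℕtoℚ j * ℕtoℚ j
2jx+j≤2x+j² zero x 0≤x x≤1 = begin
  (0ℚ * x + 0ℚ * x) + 0ℚ   ≡⟨ cong (λ y → (y + y) + 0ℚ) (*-zeroˡ x) ⟩
  (0ℚ + 0ℚ) + 0ℚ           ≤⟨ +-monoˡ-≤ 0ℚ (+-mono-≤ 0≤x 0≤x) ⟩
  (x + x) + 0ℚ             ∎
  where open ≤-Reasoning
2jx+j≤2x+j² (suc i) x 0≤x x≤1 rewrite ℕtoℚ-suc i = begin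
  ((1ℚ + ι) * x + (1ℚ + ι) * x) + (1ℚ + ι)   ≡⟨ regroup ι x ⟩
  (x + x) + ((ι * x + ι * x) + (1ℚ + ι))     ≤⟨ +-monoʳ-≤ (x + x) (+-monoˡ-≤ (1ℚ + ι) (+-mono-≤ ιx≤ι (≤-trans ιx≤ι ι≤ι²))) ⟩
  (x + x) + ((ι + ι * ι) + (1ℚ + ι))         ≡⟨ square ι x ⟩
  (x + x) + (1ℚ + ι) * (1ℚ + ι)             ∎
  where
  open ≤-Reasoning
  open +-*-Solver
  ι = ℕtoℚ i
  instance _ = nonNegative (ℕtoℚ-nonNeg i)
  ιx≤ι : ι * x ≤ ι
  ιx≤ι = ≤-trans (*-monoˡ-≤-nonNeg ι x≤1) (≤-reflexive (*-identityʳ ι))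
  ι≤ι² : ι ≤ ι * ι
  ι≤ι² = ≤-trans (ℕtoℚ-mono (i≤i² i)) (≤-reflexive (ℕtoℚ-* i i))
    where
    i≤i² : ∀ i → i ℕ.≤ i ℕ.* i
    i≤i² zero    = ℕ.z≤n
    i≤i² (suc i) = ℕ.m≤m*n (suc i) (suc i)
  regroup : ∀ ι x → ((1ℚ + ι) * x + (1ℚ + ι) * x) + (1ℚ + ι) ≡ (x + x) + ((ι * x + ι * x) + (1ℚ + ι))
  regroup = solve 2 (λ ι x → ((con 1ℚ :+ ι) :* x :+ (con 1ℚ :+ ι) :* x) :+ (con 1ℚ :+ ι)
                           := (x :+ x) :+ ((ι :* x :+ ι :* x) :+ (con 1ℚ :+ ι))) refl
  square : ∀ ι x → (x + x) + ((ι + ι * ι) + (1ℚ + ι)) ≡ (x + x) + (1ℚ + ι) * (1ℚ + ι)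
  square = solve 2 (λ ι x → (x :+ x) :+ ((ι :+ ι :* ι) :+ (con 1ℚ :+ ι))
                          := (x :+ x) :+ (con 1ℚ :+ ι) :* (con 1ℚ :+ ι)) refl

hits : (A → B → Bool) → List A → B → ℕ
hits R Es t = count (λ E → R E t) Es

weight : (A → B → Bool) → List A → List B → (B → ℚ) → ℚ
weight R Es Ω h = ∑[ E ∈ Es ] ∑[ t ∈ Ω ] ([ R E t ]· h t)

pairMass : (A → B → Bool) → List B → A → A → ℚ
pairMass R Ω E E' = ∑[ t ∈ Ω ] ([ R E t ]· [ R E' t ]· 1ℚ)

weight≡∑hits : ∀ (R : A → B → Bool) Es Ω h → weight R Es Ω h ≡ ∑[ t ∈ Ω ] (ℕtoℚ (hits R Es t) * h t)
weight≡∑hits R Es Ω h =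
  trans (∑-comm (λ E t → [ R E t ]· h t) Es Ω) (∑-cong Ω (λ t → ∑-indicator (λ E → R E t) (h t) Es))

∑pairMass≡∑hits² : ∀ (R : A → B → Bool) Es Ω →
  ∑[ E ∈ Es ] ∑[ E' ∈ Es ] pairMass R Ω E E' ≡ ∑[ t ∈ Ω ] (ℕtoℚ (hits R Es t) * ℕtoℚ (hits R Es t))
∑pairMass≡∑hits² R Es Ω = begin
  ∑[ E ∈ Es ] ∑[ E' ∈ Es ] ∑[ t ∈ Ω ] ([ R E t ]· [ R E' t ]· 1ℚ)
    ≡⟨ ∑-cong Es (λ E → ∑-comm (λ E' t → [ R E t ]· [ R E' t ]· 1ℚ) Es Ω) ⟩
  ∑[ E ∈ Es ] ∑[ t ∈ Ω ] ∑[ E' ∈ Es ] ([ R E t ]· [ R E' t ]· 1ℚ)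
    ≡⟨ ∑-cong Es (λ E → ∑-cong Ω (λ t → ∑-[]· (R E t) (λ E' → [ R E' t ]· 1ℚ) Es)) ⟩
  weight R Es Ω (λ t → ∑[ E' ∈ Es ] ([ R E' t ]· 1ℚ))
    ≡⟨ weight≡∑hits R Es Ω _ ⟩
  ∑[ t ∈ Ω ] (ℕtoℚ (hits R Es t) * ∑[ E' ∈ Es ] ([ R E' t ]· 1ℚ))
    ≡⟨ ∑-cong Ω (λ t → cong (ℕtoℚ (hits R Es t) *_) (trans (∑-indicator (λ E → R E t) 1ℚ Es) (*-identityʳ _))) ⟩
  ∑[ t ∈ Ω ] (ℕtoℚ (hits R Es t) * ℕtoℚ (hits R Es t)) ∎
  where open ≡-Reasoning

second-moment : ∀ (R : A → B → Bool) Es Ω (g : B → ℚ) → (∀ t → 0ℚ ≤ g t) → (∀ t → g t ≤ 1ℚ) →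
  (weight R Es Ω g + weight R Es Ω g) + weight R Es Ω (λ _ → 1ℚ)
    ≤ (∑ Ω g + ∑ Ω g) + ∑[ E ∈ Es ] ∑[ E' ∈ Es ] pairMass R Ω E E'
second-moment R Es Ω g 0≤g g≤1 = begin
  (weight R Es Ω g + weight R Es Ω g) + weight R Es Ω (λ _ → 1ℚ)
    ≡⟨ cong₂ _+_ (cong₂ _+_ (weight≡∑hits R Es Ω g) (weight≡∑hits R Es Ω g))
                 (trans (weight≡∑hits R Es Ω _) (∑-cong Ω (λ t → *-identityʳ (j t)))) ⟩
  (∑[ t ∈ Ω ] (j t * g t) + ∑[ t ∈ Ω ] (j t * g t)) + ∑ Ω j
    ≡⟨ ∑-twice-+ (λ t → j t * g t) j ⟨
  ∑[ t ∈ Ω ] ((j t * g t + j t * g t) + j t)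
    ≤⟨ ∑-mono Ω (λ {t} _ → 2jx+j≤2x+j² (hits R Es t) (g t) (0≤g t) (g≤1 t)) ⟩
  ∑[ t ∈ Ω ] ((g t + g t) + j t * j t)
    ≡⟨ ∑-twice-+ g (λ t → j t * j t) ⟩
  (∑ Ω g + ∑ Ω g) + ∑[ t ∈ Ω ] (j t * j t)
    ≡⟨ cong (∑ Ω g + ∑ Ω g +_) (∑pairMass≡∑hits² R Es Ω) ⟨
  (∑ Ω g + ∑ Ω g) + ∑[ E ∈ Es ] ∑[ E' ∈ Es ] pairMass R Ω E E' ∎
  where
  open ≤-Reasoning
  j : _ → ℚ
  j t = ℕtoℚ (hits R Es t)
  ∑-twice-+ : ∀ (u v : _ → ℚ) → ∑[ t ∈ Ω ] ((u t + u t) + v t) ≡ (∑ Ω u + ∑ Ω u) + ∑ Ω v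
  ∑-twice-+ u v = trans (∑-+ (λ t → u t + u t) v Ω) (cong (_+ ∑ Ω v) (∑-+ u u Ω))

∑pairMass-bound : ∀ (R : A → B → Bool) {Es} Ω {Y} → Unique Es → 0ℚ ≤ Y →
  (∀ {E E'} → E List.∈ Es → E' List.∈ Es → E' ≢ E → pairMass R Ω E E' ≤ Y) →
  ∑[ E ∈ Es ] ∑[ E' ∈ Es ] pairMass R Ω E E'
    ≤ weight R Es Ω (λ _ → 1ℚ) + ℕtoℚ (length Es) * (ℕtoℚ (length Es) * Y)
∑pairMass-bound R {Es} Ω {Y} Es-unique 0≤Y off-diagonal≤Y = begin
  ∑[ E ∈ Es ] ∑[ E' ∈ Es ] pairMass R Ω E E'
    ≤⟨ ∑-mono Es (λ E∈Es → ∑-unique-bound (pairMass R Ω _) Es-unique E∈Es 0≤Y (off-diagonal≤Y E∈Es)) ⟩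
  ∑[ E ∈ Es ] (pairMass R Ω E E + ℕtoℚ (length Es) * Y)
    ≡⟨ ∑-+ (λ E → pairMass R Ω E E) (λ _ → ℕtoℚ (length Es) * Y) Es ⟩
  ∑[ E ∈ Es ] pairMass R Ω E E + ∑[ E ∈ Es ] (ℕtoℚ (length Es) * Y)
    ≡⟨ cong₂ _+_ (∑-cong Es (λ E → ∑-cong Ω (λ t → []·-idem (R E t) 1ℚ))) (∑-const _ Es) ⟩
  weight R Es Ω (λ _ → 1ℚ) + ℕtoℚ (length Es) * (ℕtoℚ (length Es) * Y) ∎
  where open ≤-Reasoning

second-moment-bound : ∀ (R : A → B → Bool) {Es} Ω {Y} (g : B → ℚ) → Unique Es → 0ℚ ≤ Y →
  (∀ {E E'} → E List.∈ Es → E' List.∈ Es → E' ≢ E → pairMass R Ω E E' ≤ Y) →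
  (∀ t → 0ℚ ≤ g t) → (∀ t → g t ≤ 1ℚ) →
  weight R Es Ω g + weight R Es Ω g ≤ (∑ Ω g + ∑ Ω g) + ℕtoℚ (length Es) * (ℕtoℚ (length Es) * Y)
-- The diagonal of the pair sum is the first moment M₁, which cancels.
second-moment-bound R {Es} Ω {Y} g Es-unique 0≤Y off-diagonal≤Y 0≤g g≤1 = +-cancelʳ-≤ M₁ (begin
  (weight R Es Ω g + weight R Es Ω g) + M₁         ≤⟨ second-moment R Es Ω g 0≤g g≤1 ⟩
  G + ∑[ E ∈ Es ] ∑[ E' ∈ Es ] pairMass R Ω E E'   ≤⟨ +-monoʳ-≤ G (∑pairMass-bound R Ω Es-unique 0≤Y off-diagonal≤Y) ⟩
  G + (M₁ + ℓℓY)                                   ≡⟨ +-swapʳ G M₁ ℓℓY ⟩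
  (G + ℓℓY) + M₁                                   ∎)
  where
  open ≤-Reasoning
  M₁ = weight R Es Ω (λ _ → 1ℚ)
  G = ∑ Ω g + ∑ Ω g
  ℓℓY = ℕtoℚ (length Es) * (ℕtoℚ (length Es) * Y)

-- Testers for truncation by a parity

accuracy : ℚ
accuracy = ℤ.+ 99 / 100

Valid : ∀ {n m} → Algorithm n m → Set
Valid f = ∀ t → (0ℚ ≤ f t) × (f t ≤ 1ℚ)

AcceptsUniform : ∀ {n m} → Algorithm n m → Set
AcceptsUniform {n} {m} f = accuracy * numTuples (allPoints n) m ≤ weightUntrunc (allPoints n) f

RejectsTruncations : ∀ {n m} → ℕ → Algorithm n m → Set
RejectsTruncations {n} {m} k f =
  ∀ (S : Subset n) → ∣ S ∣ ≡ k → accuracy * numTuples (truncSupport S) m ≤ weightTrunc (truncSupport S) f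

accuracy-beats-second-moment : ∀ {a s G W} → 0ℚ < a → G + s ≡ a → accuracy * a ≤ s → accuracy * a ≤ W →
  ¬ (W + W ≤ (G + G) + a)
accuracy-beats-second-moment {a} {s} {G} {W} 0<a G+s≡a ra≤s ra≤W 2W≤2G+a =
  <-irrefl refl (<-≤-trans (*-monoˡ-<-pos a 3<4r) 4ra≤3a)
  where
  open ≤-Reasoning
  open +-*-Solver
  instance _ = positive 0<a
  r = accuracy
  3<4r : 1ℚ + 1ℚ + 1ℚ < r + r + r + r
  3<4r = from-yes (1ℚ + 1ℚ + 1ℚ <? r + r + r + r)
  4ra≤3a : (r + r + r + r) * a ≤ (1ℚ + 1ℚ + 1ℚ) * a
  4ra≤3a = begin
    (r + r + r + r) * a                  ≡⟨ solve 2 (λ r a → (r :+ r :+ r :+ r) :* a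
                                                   := (r :* a :+ r :* a) :+ (r :* a :+ r :* a)) refl r a ⟩
    (r * a + r * a) + (r * a + r * a)    ≤⟨ +-mono-≤ (+-mono-≤ ra≤W ra≤W) (+-mono-≤ ra≤s ra≤s) ⟩
    (W + W) + (s + s)                    ≤⟨ +-monoˡ-≤ (s + s) 2W≤2G+a ⟩
    ((G + G) + a) + (s + s)              ≡⟨ solve 3 (λ G s a → ((G :+ G) :+ a) :+ (s :+ s)
                                                   := ((G :+ s) :+ (G :+ s)) :+ a) refl G s a ⟩
    ((G + s) + (G + s)) + a              ≡⟨ cong (λ x → (x + x) + a) G+s≡a ⟩
    (a + a) + a                          ≡⟨ solve 1 (λ a → (a :+ a) :+ a := (con 1ℚ :+ con 1ℚ :+ con 1ℚ) :* a) refl a ⟩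
    (1ℚ + 1ℚ + 1ℚ) * a                   ∎

inSupport : ∀ {n m} → Subset n → Vec (Point n) m → Bool
inSupport S = allᵇ (χ S)

numTuples-allPoints : ∀ n m → numTuples (allPoints n) m ≡ ℕtoℚ ((2 ^ n) ^ m)
numTuples-allPoints n m = cong ℕtoℚ (trans (length-tuples (allPoints n) m) (cong (_^ m) (length-allPoints n)))

numTuples-allPoints-pos : ∀ n m → 0ℚ < numTuples (allPoints n) m
numTuples-allPoints-pos n m = begin-strict
  0ℚ                          <⟨ from-yes (0ℚ <? 1ℚ) ⟩
  ℕtoℚ 1                      ≤⟨ ℕtoℚ-mono (ℕ.m^n>0 (2 ^ n) {{ℕ.m^n≢0 2 n}} m) ⟩
  ℕtoℚ ((2 ^ n) ^ m)          ≡⟨ numTuples-allPoints n m ⟨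
  numTuples (allPoints n) m   ∎
  where open ≤-Reasoning

numTuples-truncation : ∀ {n} m (S : Subset (suc n)) → Nonempty S → numTuples (truncSupport S) m ≡ ℕtoℚ ((2 ^ n) ^ m)
numTuples-truncation {n} m S S≢∅ =
  cong ℕtoℚ (trans (length-tuples-filterᵇ (χ S) (allPoints (suc n)) m) (cong (_^ m) (count-truncation S S≢∅)))

pairMass-truncations : ∀ {n} m (S S' : Subset (2 ℕ.+ n)) → Nonempty S → Nonempty S' → S ≢ S' →
  pairMass inSupport (tuples (allPoints (2 ℕ.+ n)) m) S S' ≡ ℕtoℚ ((2 ^ n) ^ m)
pairMass-truncations {n} m S S' S≢∅ S'≢∅ S≢S' = begin
  ∑[ t ∈ T ] ([ inSupport S t ]· [ inSupport S' t ]· 1ℚ)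
    ≡⟨ ∑-cong T (λ t → trans ([]·-∧ (inSupport S t) _ 1ℚ) (cong ([_]· 1ℚ) (allᵇ-∧ (χ S) (χ S') t))) ⟩
  ∑[ t ∈ T ] ([ allᵇ (λ x → χ S x ∧ χ S' x) t ]· 1ℚ)
    ≡⟨ ∑-tuples-allᵇ (λ x → χ S x ∧ χ S' x) (allPoints (2 ℕ.+ n)) m ⟩
  ℕtoℚ (count (λ x → χ S x ∧ χ S' x) (allPoints (2 ℕ.+ n)) ^ m)
    ≡⟨ cong (λ c → ℕtoℚ (c ^ m)) (count-truncation-pair S S' S≢∅ S'≢∅ S≢S') ⟩
  ℕtoℚ ((2 ^ n) ^ m) ∎
  where
  open ≡-Reasoning
  T = tuples (allPoints (2 ℕ.+ n)) m

∑weightTrunc≡weight : ∀ {n m} Ss (f : Algorithm n m) →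
  ∑[ S ∈ Ss ] weightTrunc (truncSupport S) f ≡ weight inSupport Ss (tuples (allPoints n) m) (λ t → 1ℚ - f t)
∑weightTrunc≡weight {n} {m} Ss f = ∑-cong Ss (λ S → ∑-tuples-filterᵇ (χ S) (allPoints n) m (λ t → 1ℚ - f t))

rejections+acceptances : ∀ (f : A → ℚ) xs → ∑[ x ∈ xs ] (1ℚ - f x) + ∑ xs f ≡ ℕtoℚ (length xs)
rejections+acceptances f xs = begin
  ∑[ x ∈ xs ] (1ℚ - f x) + ∑ xs f      ≡⟨ ∑-+ (λ x → 1ℚ - f x) f xs ⟨
  ∑[ x ∈ xs ] ((1ℚ - f x) + f x)      ≡⟨ ∑-cong xs (λ x → solve 1 (λ y → (con 1ℚ :- y) :+ y := con 1ℚ) refl (f x)) ⟩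
  ∑[ x ∈ xs ] 1ℚ                      ≡⟨ ∑-const 1ℚ xs ⟩
  ℕtoℚ (length xs) * 1ℚ               ≡⟨ *-identityʳ _ ⟩
  ℕtoℚ (length xs)                    ∎
  where
  open ≡-Reasoning
  open +-*-Solver

weight-of-rejections : ∀ {n k m} (f : Algorithm (suc n) m) → 1 ℕ.≤ k → RejectsTruncations k f →
  ∀ Ss → All (λ S → ∣ S ∣ ≡ k) Ss →
  accuracy * (ℕtoℚ (length Ss) * ℕtoℚ ((2 ^ n) ^ m)) ≤ weight inSupport Ss (tuples (allPoints (suc n)) m) (λ t → 1ℚ - f t)
weight-of-rejections {n} {k} {m} f 1≤k rejects Ss sizes = begin
  accuracy * (ℕtoℚ (length Ss) * Z)            ≡⟨ x∙yz≈y∙xz accuracy (ℕtoℚ (length Ss)) Z ⟩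
  ℕtoℚ (length Ss) * (accuracy * Z)            ≡⟨ ∑-const (accuracy * Z) Ss ⟨
  ∑[ S ∈ Ss ] (accuracy * Z)                   ≤⟨ ∑-mono Ss rejected ⟩
  ∑[ S ∈ Ss ] weightTrunc (truncSupport S) f   ≡⟨ ∑weightTrunc≡weight Ss f ⟩
  weight inSupport Ss (tuples (allPoints (suc n)) m) (λ t → 1ℚ - f t) ∎
  where
  open ≤-Reasoning
  open CommutativeSemigroupProperties (CommutativeMonoid.commutativeSemigroup *-1-commutativeMonoid)
    using (x∙yz≈y∙xz)
  Z = ℕtoℚ ((2 ^ n) ^ m)
  rejected : ∀ {S} → S List.∈ Ss → accuracy * Z ≤ weightTrunc (truncSupport S) f
  rejected {S} S∈Ss =
    subst (λ z → accuracy * z ≤ weightTrunc (truncSupport S) f) (numTuples-truncation m S S≢∅) (rejects S ∣S∣≡k)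
    where
    ∣S∣≡k = All.lookup sizes S∈Ss
    S≢∅ = ∣p∣>0⇒Nonempty S (subst (1 ℕ.≤_) (sym ∣S∣≡k) 1≤k)

no-tester-with-few-samples : ∀ n {k m} (f : Algorithm (2 ℕ.+ n) m) → 1 ℕ.≤ k →
  Valid f → AcceptsUniform f → RejectsTruncations k f → ¬ (2 ^ m ℕ.< (2 ℕ.+ n) C k)
no-tester-with-few-samples n {k} {m} f 1≤k valid accepts rejects 2^m<C =
  accuracy-beats-second-moment {G = G} {W} (numTuples-allPoints-pos (2 ℕ.+ n) m) (rejections+acceptances f T)
    accepts (subst (λ x → accuracy * x ≤ W) ℓZ≡a (weight-of-rejections f 1≤k rejects Ss sizes))
    (subst (λ x → W + W ≤ (G + G) + x) ℓℓY≡a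
      (second-moment-bound inSupport T g (Unique.take⁺ (2 ^ m) (subsetsOfSize-unique _ k))
        (ℕtoℚ-nonNeg ((2 ^ n) ^ m)) off-diagonal (proj₁ ∘ 0≤g≤1) (proj₂ ∘ 0≤g≤1)))
  where
  P = allPoints (2 ℕ.+ n)
  T = tuples P m
  g = λ t → 1ℚ - f t
  G = ∑ T g
  Ss = take (2 ^ m) (subsetsOfSize (2 ℕ.+ n) k)
  W = weight inSupport Ss T g
  sizes = All.take⁺ (2 ^ m) (subsetsOfSize-size (2 ℕ.+ n) k)
  nonempty : ∀ {S} → S List.∈ Ss → Nonempty S
  nonempty {S} S∈Ss = ∣p∣>0⇒Nonempty S (subst (1 ℕ.≤_) (sym (All.lookup sizes S∈Ss)) 1≤k)
  off-diagonal : ∀ {S S'} → S List.∈ Ss → S' List.∈ Ss → S' ≢ S → pairMass inSupport T S S' ≤ ℕtoℚ ((2 ^ n) ^ m)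
  off-diagonal S∈ S'∈ S'≢S = ≤-reflexive (pairMass-truncations m _ _ (nonempty S∈) (nonempty S'∈) (≢-sym S'≢S))
  0≤g≤1 : ∀ t → 0ℚ ≤ g t × g t ≤ 1ℚ
  0≤g≤1 t = 1-x∈[0,1] (proj₁ (valid t)) (proj₂ (valid t))
  length-Ss : length Ss ≡ 2 ^ m
  length-Ss = trans (length-take (2 ^ m) _)
    (trans (cong (2 ^ m ℕ.⊓_) (length-subsetsOfSize (2 ℕ.+ n) k)) (ℕ.m≤n⇒m⊓n≡m (ℕ.<⇒≤ 2^m<C)))
  ℓY≡Z : ℕtoℚ (length Ss) * ℕtoℚ ((2 ^ n) ^ m) ≡ ℕtoℚ ((2 ^ suc n) ^ m)
  ℓY≡Z = trans (cong (λ ℓ → ℕtoℚ ℓ * _) length-Ss) (ℕtoℚ-doubling n m)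
  ℓZ≡a : ℕtoℚ (length Ss) * ℕtoℚ ((2 ^ suc n) ^ m) ≡ numTuples P m
  ℓZ≡a = trans (cong (λ ℓ → ℕtoℚ ℓ * _) length-Ss)
               (trans (ℕtoℚ-doubling (suc n) m) (sym (numTuples-allPoints (2 ℕ.+ n) m)))
  ℓℓY≡a : ℕtoℚ (length Ss) * (ℕtoℚ (length Ss) * ℕtoℚ ((2 ^ n) ^ m)) ≡ numTuples P m
  ℓℓY≡a = trans (cong (ℕtoℚ (length Ss) *_) ℓY≡Z) ℓZ≡a

proposition4p2 :
  ∃[ d ] (∀ (n k : ℕ) → 1 ℕ.≤ k → k ℕ.≤ n → ∀ (m : ℕ) (f : Algorithm n m) →
    (∀ t → (0ℚ ≤ f t) × (f t ≤ 1ℚ)) →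
    ((ℤ.+ 99 / 100) * numTuples (allPoints n) m ≤ weightUntrunc (allPoints n) f) →
    (∀ (S : Subset n) → ∣ S ∣ ≡ k →
      (ℤ.+ 99 / 100) * numTuples (truncSupport S) m ≤ weightTrunc (truncSupport S) f) →
    n C k ℕ.≤ 2 ^ (d ℕ.* m))
-- For n ≤ 1 the binomial coefficient is at most 1.
proposition4p2 = 1 , λ where
  zero          (suc k)       _   _ _ _ _     _       _       → ℕ.z≤n
  (suc zero)    (suc zero)    _   _ m _ _     _       _       → ℕ.m^n>0 2 (1 ℕ.* m)
  (suc zero)    (suc (suc k)) _   _ _ _ _     _       _       → ℕ.z≤n
  (suc (suc n)) k             1≤k _ m f valid accepts rejects →
    subst (λ e → suc (suc n) C k ℕ.≤ 2 ^ e) (sym (ℕ.*-identityˡ m))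
          (ℕ.≮⇒≥ (no-tester-with-few-samples n f 1≤k valid accepts rejects))
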